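{- Let $G=(V,E)$ be a chordal graph. Then the set $C^1(G)=\{v\in V: e(v)\le\mathrm{rad}(G)+1\}$ is a tight upper certificate of $G$, i.e. $e(u)=\min_{x\in C^1(G)}(d(u,x)+e(x))$ for every $u\in V$.
   Context: $G$ is finite, connected, undirected, unweighted; chordal means every induced cycle of length at least 4 has a chord. $d$ is shortest-path distance, $e(u)=\max_v d(u,v)$, $\mathrm{rad}(G)=\min_u e(u)$. -}

module Defs where

open import Data.Nat using (ℕ; zero; suc; _+_; _≤_; _∸_)
open import Data.Fin using (Fin; toℕ)
open import Data.Bool using (Bool; true; false)
open import Data.Product using (Σ; ∃; ∃-syntax; _×_; _,_)
open import Data.Sum using (_⊎_)
open import Relation.Binary.PropositionalEquality using (_≡_; _≢_)
open import Relation.Nullary using (¬_)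
open import Function.Definitions using (Injective)

record Graph (n : ℕ) : Set where
  field
    adj   : Fin n → Fin n → Bool
    sym   : ∀ u v → adj u v ≡ adj v u
    irrefl : ∀ u → adj u u ≡ false
open Graph public

module _ {n : ℕ} (G : Graph n) where

  data Walk : Fin n → Fin n → ℕ → Set where
    here : ∀ {u} → Walk u u 0
    step : ∀ {u w v k} → adj G u w ≡ true → Walk w v k → Walk u v (suc k)

  Connected : Set
  Connected = ∀ u v → ∃[ k ] Walk u v k

  IsDist : Fin n → Fin n → ℕ → Set
  IsDist u v k = Walk u v k × (∀ m → Walk u v m → k ≤ m)

  IsEcc : Fin n → ℕ → Set
  IsEcc u k = (∀ v m → IsDist u v m → m ≤ k) × (∃[ v ] IsDist u v k)

  IsRad : ℕ → Set
  IsRad r = (∃[ u ] IsEcc u r) × (∀ u k → IsEcc u k → r ≤ k)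

  CycNext : (m : ℕ) → Fin m → Fin m → Set
  CycNext m i j = (toℕ j ≡ suc (toℕ i)) ⊎ ((toℕ i ≡ m ∸ 1) × (toℕ j ≡ 0))

  IsCycle : (m : ℕ) → (Fin m → Fin n) → Set
  IsCycle m c = Injective _≡_ _≡_ c × (∀ i j → CycNext m i j → adj G (c i) (c j) ≡ true)

  HasChord : (m : ℕ) → (Fin m → Fin n) → Set
  HasChord m c = ∃[ i ] ∃[ j ] (i ≢ j × ¬ CycNext m i j × ¬ CycNext m j i
                                  × adj G (c i) (c j) ≡ true)

  Chordal : Set
  Chordal = ∀ m (c : Fin m → Fin n) → 4 ≤ m → IsCycle m c → HasChord m c

  InC1 : ℕ → Fin n → Set
  InC1 r v = ∃[ k ] (IsEcc v k × k ≤ r + 1)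

module Submission where

-- If e(v) ≥ rad(G) + 2, some neighbour w of v has e(w) = e(v) − 1. Following such neighbours
-- from u until the eccentricity drops to rad(G) + 1 reaches an x ∈ C¹(G) with
-- e(u) = d(u,x) + e(x); the triangle inequality gives ≤ for every x.
-- To find w, let Toward z be the set of neighbours of v on geodesics from v to z. Chordality
-- enters through one fact about the layers of the distance to z: two vertices of a layer joined
-- by a walk that never goes below it have equal or adjacent neighbours in the next layer down,
-- for otherwise there is a chordless cycle of length at least 4. It makes Toward z and Toward y
-- comparable under inclusion whenever d(z,y) + 3 ≤ d(v,z) + d(v,y), which holds for the
-- vertices farthest from v and a central vertex c. A neighbour in all these sets is closer than
-- v to every farthest vertex, and the same layer fact, now around c, keeps it within e(v) − 1
-- of the remaining vertices.

open import Defs hiding (sym)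
open import Data.Nat using (ℕ; zero; suc; _+_; _∸_; _≤_; _<_; _≤?_; _<?_; z≤n; s≤s)
open import Data.Nat.Properties
open import Data.Nat.Induction using (<-rec)
open import Data.Nat.Tactic.RingSolver using (solve-∀)
open import Data.Fin using (Fin; toℕ) renaming (_≟_ to _≟ᶠ_)
open import Data.Fin.Properties using (any?; toℕ-injective; toℕ<n)
open import Data.Bool using (true)
import Data.Bool.Properties as Bool
open import Data.Product using (Σ; ∃; ∃-syntax; _×_; _,_; proj₁; proj₂; swap)
open import Data.Sum using (_⊎_; inj₁; inj₂; map₁)
open import Data.Empty using (⊥; ⊥-elim)
open import Relation.Nullary using (¬_; Dec; yes; no; contradiction)
open import Relation.Nullary.Decidable using (_×-dec_; _⊎-dec_; ¬?; decidable-stable)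
open import Relation.Unary using (Pred; Decidable; _⊆_)
open import Data.List using ([]; _∷_; allFin)
open import Data.List.Membership.Propositional using (_∈_)
open import Data.List.Membership.Propositional.Properties using (∈-allFin)
open import Data.List.Relation.Unary.Any using (here; there)
open import Level using (0ℓ)
open import Relation.Binary.PropositionalEquality
open import Function using (_∘_; id)
open import Relation.Binary.Definitions using (tri<; tri≈; tri>)

least-witness : ∀ {p} {P : Pred ℕ p} → Decidable P →
                ∀ k → P k → ∃ λ m → P m × (∀ j → j < m → ¬ P j)
least-witness {P = P} P? = <-rec Goal search
  where
  Goal : ℕ → Set _
  Goal k = P k → ∃ λ m → P m × (∀ j → j < m → ¬ P j)

  search : ∀ k → (∀ {j} → j < k → Goal j) → Goal k
  search k below Pk with anyUpTo? P? k
  ... | yes (j , j<k , Pj) = below j<k Pj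
  ... | no none = k , Pk , λ j j<k Pj → none (j , j<k , Pj)

module _ {a b ℓ} {A : Set a} {B : Set b} (S : A → Pred B ℓ) {Good Cand : Pred A ℓ} (cand? : Decidable Cand)
         (comparable : ∀ {z x} → Good z → Cand x → S z ⊆ S x ⊎ S x ⊆ S z × Good x) where

  advance : ∀ {z} → Good z → ∀ x → ∃ λ z₁ → Good z₁ × S z₁ ⊆ S z × (Cand x → S z₁ ⊆ S x)
  advance good x with cand? x
  ... | no ¬cand = _ , good , id , λ cand → contradiction cand ¬cand
  ... | yes cand with comparable good cand
  ...   | inj₁ z⊆x = _ , good , id , λ _ → z⊆x
  ...   | inj₂ (x⊆z , good-x) = x , good-x , x⊆z , λ _ → id

  least-image : ∀ xs {z} → Good z → ∃ λ z′ → Good z′ × S z′ ⊆ S z × (∀ {y} → y ∈ xs → Cand y → S z′ ⊆ S y)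
  least-image [] good = _ , good , id , λ ()
  least-image (x ∷ xs) good with advance good x
  ... | z₁ , good₁ , z₁⊆z , z₁⊆x with least-image xs good₁
  ...   | z′ , good′ , z′⊆z₁ , below = z′ , good′ , z₁⊆z ∘ z′⊆z₁ ,
          λ { (here refl) cand → z₁⊆x cand ∘ z′⊆z₁ ; (there y∈xs) → below y∈xs }

module Walks {n : ℕ} (G : Graph n) where

  infix 4 _~_
  _~_ : Fin n → Fin n → Set
  x ~ y = adj G x y ≡ true

  ~-sym : ∀ {x y} → x ~ y → y ~ x
  ~-sym {x} {y} = trans (Graph.sym G y x)

  _~?_ : ∀ x y → Dec (x ~ y)
  x ~? y = adj G x y Bool.≟ true

  walk? : ∀ m x y → Dec (Walk G x y m)
  walk? zero x y with x ≟ᶠ y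
  ... | yes refl = yes here
  ... | no x≢y = no λ { here → x≢y refl }
  walk? (suc m) x y with any? (λ w → (x ~? w) ×-dec walk? m w y)
  ... | yes (w , x~w , rest) = yes (step x~w rest)
  ... | no none = no λ { (step {w = w} x~w rest) → none (w , x~w , rest) }

  infixr 5 _++ʷ_
  _++ʷ_ : ∀ {x y z a b} → Walk G x y a → Walk G y z b → Walk G x z (a + b)
  here ++ʷ q = q
  step e p ++ʷ q = step e (p ++ʷ q)

  reverseʷ : ∀ {x y a} → Walk G x y a → Walk G y x a
  reverseʷ here = here
  reverseʷ {a = suc a} (step e p) = subst (Walk G _ _) (+-comm a 1) (reverseʷ p ++ʷ step (~-sym e) here)

  data WalkIn (P : Pred (Fin n) 0ℓ) : Fin n → Fin n → Set where
    stay : ∀ {a} → P a → WalkIn P a a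
    move : ∀ {a b c} → P a → a ~ b → WalkIn P b c → WalkIn P a c

  module _ {P : Pred (Fin n) 0ℓ} where

    walkIn-start : ∀ {a b} → WalkIn P a b → P a
    walkIn-start (stay Pa) = Pa
    walkIn-start (move Pa _ _) = Pa

    walkIn-end : ∀ {a b} → WalkIn P a b → P b
    walkIn-end (stay Pa) = Pa
    walkIn-end (move _ _ rest) = walkIn-end rest

    infixr 5 _++ⁱ_
    _++ⁱ_ : ∀ {a b c} → WalkIn P a b → WalkIn P b c → WalkIn P a c
    stay _ ++ⁱ q = q
    move Pa e p ++ⁱ q = move Pa e (p ++ⁱ q)

    snocⁱ : ∀ {a b c} → WalkIn P a b → b ~ c → P c → WalkIn P a c
    snocⁱ p e Pc = p ++ⁱ move (walkIn-end p) e (stay Pc)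

    reverseⁱ : ∀ {a b} → WalkIn P a b → WalkIn P b a
    reverseⁱ (stay Pa) = stay Pa
    reverseⁱ (move Pa e p) = snocⁱ (reverseⁱ p) (~-sym e) Pa

module Distance {n : ℕ} (G : Graph n) (connected : Connected G) where
  open Walks G

  shortest : ∀ x y → ∃ λ d → Walk G x y d × (∀ m → m < d → ¬ Walk G x y m)
  shortest x y = least-witness (λ m → walk? m x y) (proj₁ (connected x y)) (proj₂ (connected x y))

  dist : Fin n → Fin n → ℕ
  dist x y = proj₁ (shortest x y)

  dist-walk : ∀ x y → Walk G x y (dist x y)
  dist-walk x y = proj₁ (proj₂ (shortest x y))

  dist-minimal : ∀ {x y m} → Walk G x y m → dist x y ≤ m
  dist-minimal {x} {y} p = ≮⇒≥ λ m<d → proj₂ (proj₂ (shortest x y)) _ m<d p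

  isDist-dist : ∀ x y → IsDist G x y (dist x y)
  isDist-dist x y = dist-walk x y , λ _ → dist-minimal

  IsDist⇒≡dist : ∀ {x y k} → IsDist G x y k → k ≡ dist x y
  IsDist⇒≡dist {x} {y} (p , minimal) = ≤-antisym (minimal _ (dist-walk x y)) (dist-minimal p)

  dist-triangle : ∀ x y z → dist x z ≤ dist x y + dist y z
  dist-triangle x y z = dist-minimal (dist-walk x y ++ʷ dist-walk y z)

  dist-sym : ∀ x y → dist x y ≡ dist y x
  dist-sym x y = ≤-antisym (dist-minimal (reverseʷ (dist-walk y x)))
                           (dist-minimal (reverseʷ (dist-walk x y)))

  dist-self : ∀ x → dist x x ≡ 0
  dist-self x = n≤0⇒n≡0 (dist-minimal here)

  dist≡0⇒≡ : ∀ {x y} → dist x y ≡ 0 → x ≡ y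
  dist≡0⇒≡ {x} {y} d≡0 with dist x y | dist-walk x y
  ... | .0 | here = refl

  dist-~ : ∀ {x y} → x ~ y → dist x y ≤ 1
  dist-~ x~y = dist-minimal (step x~y here)

  dist-≡⊎~ : ∀ {x y} z → x ≡ y ⊎ x ~ y → dist x z ≤ suc (dist y z)
  dist-≡⊎~ {x} z (inj₁ refl) = n≤1+n (dist x z)
  dist-≡⊎~ {x} {y} z (inj₂ x~y) = ≤-trans (dist-triangle x y z) (+-monoˡ-≤ (dist y z) (dist-~ x~y))

  dist-~-≤ : ∀ {x y} z → x ~ y → dist x z ≤ suc (dist y z)
  dist-~-≤ z x~y = dist-≡⊎~ z (inj₂ x~y)

  dist-next : ∀ {x y d} → dist x y ≡ suc d → ∃ λ w → x ~ w × dist w y ≡ d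
  dist-next {x} {y} {d} eq = next (dist-walk x y) eq
    where
    next : ∀ {k} → Walk G x y k → k ≡ suc d → ∃ λ w → x ~ w × dist w y ≡ d
    next (step {w = w} x~w p) refl = w , x~w ,
      ≤-antisym (dist-minimal p) (≤-pred (subst (_≤ suc (dist w y)) eq (dist-~-≤ y x~w)))

  dist-toward : ∀ {x y} → 0 < dist x y → ∃ λ w → x ~ w × dist w y < dist x y
  dist-toward {x} {y} 0<d with dist x y in eq
  ... | suc d with dist-next eq
  ...   | w , x~w , dw≡d = w , x~w , s≤s (≤-reflexive dw≡d)

  Ecc : Fin n → ℕ → Set
  Ecc u k = (∀ y → dist u y ≤ k) × ∃ λ y → dist u y ≡ k

  IsEcc⇒Ecc : ∀ {u k} → IsEcc G u k → Ecc u k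
  IsEcc⇒Ecc {u} (bounded , y , attained) =
    (λ y → bounded y (dist u y) (isDist-dist u y)) , y , sym (IsDist⇒≡dist attained)

  Ecc⇒IsEcc : ∀ {u k} → Ecc u k → IsEcc G u k
  Ecc⇒IsEcc {u} {k} (bounded , y , attained) =
    (λ y m d → subst (_≤ k) (sym (IsDist⇒≡dist d)) (bounded y)) ,
    y , subst (IsDist G u y) attained (isDist-dist u y)

  ecc-triangle : ∀ {u x eu ex} → Ecc u eu → Ecc x ex → eu ≤ dist u x + ex
  ecc-triangle {u} {x} (_ , y , refl) (bounded , _) =
    ≤-trans (dist-triangle u x y) (+-monoʳ-≤ (dist u x) (bounded y))

  isEcc-triangle : ∀ {u x eu dx ex} → IsEcc G u eu → IsDist G u x dx → IsEcc G x ex → eu ≤ dx + ex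
  isEcc-triangle ecc-u dist-x ecc-x =
    subst (λ d → _ ≤ d + _) (sym (IsDist⇒≡dist dist-x)) (ecc-triangle (IsEcc⇒Ecc ecc-u) (IsEcc⇒Ecc ecc-x))

module Routes {n : ℕ} (G : Graph n) where
  open Walks G

  record Route (U : Pred (Fin n) 0ℓ) (a b : Fin n) (L : ℕ) : Set where
    field
      at       : ℕ → Fin n
      at-start : at 0 ≡ a
      at-end   : at L ≡ b
      edge     : ∀ i → i < L → at i ~ at (suc i)
      interior : ∀ i → 0 < i → i < L → U (at i)

  record Induced {U a b L} (p : Route U a b L) : Set where
    open Route p
    field
      distinct  : ∀ i j → i < j → j ≤ L → at i ≢ at j
      chordless : ∀ i j → suc i < j → j ≤ L → ¬ at i ~ at j

  module _ {U : Pred (Fin n) 0ℓ} where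

    single : ∀ {a b} → a ~ b → Route U a b 1
    single {a} {b} a~b = record
      { at = λ { zero → a ; (suc _) → b } ; at-start = refl ; at-end = refl
      ; edge = λ { zero _ → a~b ; (suc _) (s≤s ()) } ; interior = λ { (suc _) _ (s≤s ()) } }

    cons : ∀ {a b c L} → a ~ b → U b → Route U b c L → Route U a c (suc L)
    cons {a} a~b Ub p = record
      { at = λ { zero → a ; (suc i) → at i }
      ; at-start = refl
      ; at-end = at-end
      ; edge = λ { zero _ → subst (a ~_) (sym at-start) a~b ; (suc i) (s≤s i<L) → edge i i<L }
      ; interior = λ { (suc zero) _ _ → subst U (sym at-start) Ub
                     ; (suc (suc i)) _ (s≤s i<L) → interior (suc i) (s≤s z≤n) i<L } }
      where open Route p

    bracket : ∀ {a x y b} → a ~ x → WalkIn U x y → y ~ b → ∃ λ L → Route U a b L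
    bracket a~x (stay Ux) x~b = 2 , cons a~x Ux (single x~b)
    bracket a~x (move Ux x~w rest) y~b with bracket x~w rest y~b
    ... | L , p = suc L , cons a~x Ux p

  module _ {U : Pred (Fin n) 0ℓ} {a b L} (p : Route U a b L) where
    open Route p

    truncate : ∀ i → i < L → at i ≡ b → Route U a b i
    truncate i i<L at-i = record
      { at = at ; at-start = at-start ; at-end = at-i
      ; edge = λ k k<i → edge k (<-trans k<i i<L)
      ; interior = λ k 0<k k<i → interior k 0<k (<-trans k<i i<L) }

    shortcut : ∀ i s L′ → i < L′ → L′ + suc s ≡ L → at i ~ at (suc i + suc s) → Route U a b L′
    shortcut i s L′ i<L′ split jump = record
      { at = at′
      ; at-start = trans (at′-≤ z≤n) at-start
      ; at-end = trans (at′-> i<L′) (trans (cong at split) at-end)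
      ; edge = edge′
      ; interior = interior′ }
      where
      at′ : ℕ → Fin n
      at′ k with k ≤? i
      ... | yes _ = at k
      ... | no _ = at (k + suc s)

      at′-≤ : ∀ {k} → k ≤ i → at′ k ≡ at k
      at′-≤ {k} k≤i with k ≤? i
      ... | yes _ = refl
      ... | no k≰i = contradiction k≤i k≰i

      at′-> : ∀ {k} → i < k → at′ k ≡ at (k + suc s)
      at′-> {k} i<k with k ≤? i
      ... | yes k≤i = contradiction k≤i (<⇒≱ i<k)
      ... | no _ = refl

      L′≤L : L′ ≤ L
      L′≤L = subst (L′ ≤_) split (m≤m+n L′ (suc s))

      shifted< : ∀ {k} → k < L′ → k + suc s < L
      shifted< k<L′ = subst (_ ≤_) split (+-monoˡ-≤ (suc s) k<L′)

      edge′ : ∀ k → k < L′ → at′ k ~ at′ (suc k)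
      edge′ k sk≤L′ with <-cmp k i
      ... | tri< k<i _ _ = subst₂ _~_ (sym (at′-≤ (<⇒≤ k<i))) (sym (at′-≤ k<i))
                                     (edge k (<-≤-trans sk≤L′ L′≤L))
      ... | tri≈ _ refl _ = subst₂ _~_ (sym (at′-≤ ≤-refl)) (sym (at′-> ≤-refl)) jump
      ... | tri> _ _ i<k = subst₂ _~_ (sym (at′-> i<k)) (sym (at′-> (m<n⇒m<1+n i<k)))
                                     (edge (k + suc s) (shifted< sk≤L′))

      interior′ : ∀ k → 0 < k → k < L′ → U (at′ k)
      interior′ k 0<k k<L′ with k ≤? i
      ... | yes _ = interior k 0<k (<-≤-trans k<L′ L′≤L)
      ... | no _ = interior (k + suc s) (<-≤-trans 0<k (m≤m+n k (suc s))) (shifted< k<L′)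

    skip : ∀ i j → suc i < j → j ≤ L → at i ~ at j → ∃ λ L′ → L′ < L × Route U a b L′
    skip i j si<j j≤L chord with m≤n⇒∃[o]m+o≡n si<j | m≤n⇒∃[o]m+o≡n j≤L
    ... | s , refl | e , refl =
      suc i + e , subst (suc i + e <_) (split i e s) (m<m+n (suc i + e) (s≤s z≤n)) ,
      shortcut i s (suc i + e) (s≤s (m≤m+n i e)) (split i e s)
               (subst (λ k → at i ~ at k) (sym (+-suc (suc i) s)) chord)
      where
      split : ∀ i e s → suc i + e + suc s ≡ suc (suc i) + s + e
      split = solve-∀

    Defect : ℕ → ℕ → Set
    Defect i j = i < j × j ≤ L × (at i ≡ at j ⊎ suc i < j × at i ~ at j)

    defect? : Dec (∃ λ i → i < suc L × ∃ λ j → j < suc L × Defect i j)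
    defect? = anyUpTo? (λ i → anyUpTo? (λ j → defect-at? i j) (suc L)) (suc L)
      where
      defect-at? : ∀ i j → Dec (Defect i j)
      defect-at? i j = (i <? j) ×-dec (j ≤? L) ×-dec ((at i ≟ᶠ at j) ⊎-dec ((suc i <? j) ×-dec (at i ~? at j)))

    defect-free⇒induced : ¬ (∃ λ i → i < suc L × ∃ λ j → j < suc L × Defect i j) → Induced p
    defect-free⇒induced none = record
      { distinct = λ i j i<j j≤L eq → report i<j j≤L (inj₁ eq)
      ; chordless = λ i j si<j j≤L i~j → report (<-trans (n<1+n i) si<j) j≤L (inj₂ (si<j , i~j)) }
      where
      report : ∀ {i j} → i < j → j ≤ L → (at i ≡ at j ⊎ suc i < j × at i ~ at j) → ⊥
      report {i} {j} i<j j≤L bad = none (i , <-≤-trans i<j (m≤n⇒m≤1+n j≤L) , j , s≤s j≤L , i<j , j≤L , bad)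

    remove-defect : ∀ {i j} → Defect i j → ∃ λ L′ → L′ < L × Route U a b L′
    remove-defect {i} {j} (i<j , j≤L , inj₂ (si<j , chord)) = skip i j si<j j≤L chord
    remove-defect {i} {j} (i<j , j≤L , inj₁ repeat) with m≤n⇒m<n∨m≡n j≤L
    ... | inj₂ refl = i , i<j , truncate i i<j (trans repeat at-end)
    ... | inj₁ j<L = skip i (suc j) (s≤s i<j) j<L (subst (_~ at (suc j)) (sym repeat) (edge j j<L))

  induced-route : ∀ {U a b L} → Route U a b L → ∃ λ L′ → Σ (Route U a b L′) Induced
  induced-route {U} {a} {b} {L} = <-rec Goal reduce L
    where
    Goal : ℕ → Set
    Goal L = Route U a b L → ∃ λ L′ → Σ (Route U a b L′) Induced

    reduce : ∀ L → (∀ {L′} → L′ < L → Goal L′) → Goal L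
    reduce L shorter p with defect? p
    ... | no none = L , p , defect-free⇒induced p none
    ... | yes (_ , _ , _ , _ , defect) with remove-defect p defect
    ...   | L′ , L′<L , p′ = shorter L′<L p′

module Gluing {n : ℕ} {G : Graph n} {U₁ U₂ : Pred (Fin n) 0ℓ} {a a′ : Fin n} {L₁ l₂ : ℕ}
  (disjoint : ∀ {x} → U₁ x → ¬ U₂ x) (apart : ∀ {x y} → U₁ x → U₂ y → ¬ Walks._~_ G x y)
  (p : Routes.Route G U₁ a a′ L₁) (p-induced : Routes.Induced G p)
  (q : Routes.Route G U₂ a′ a (suc l₂)) (q-induced : Routes.Induced G q) where
  open Walks G
  open Routes G

  private
    module P = Route p
    module Q = Route q
    module P′ = Induced p-induced
    module Q′ = Induced q-induced

  m : ℕ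
  m = L₁ + suc l₂

  glued : ℕ → Fin n
  glued k with k ≤? L₁
  ... | yes _ = P.at k
  ... | no _ = Q.at (k ∸ L₁)

  glued-p : ∀ {k} → k ≤ L₁ → glued k ≡ P.at k
  glued-p {k} k≤L₁ with k ≤? L₁
  ... | yes _ = refl
  ... | no k≰L₁ = contradiction k≤L₁ k≰L₁

  glued-q : ∀ j → glued (L₁ + j) ≡ Q.at j
  glued-q j with L₁ + j ≤? L₁
  ... | no _ = cong Q.at (m+n∸m≡n L₁ j)
  glued-q zero | yes _ = trans (cong P.at (+-identityʳ L₁)) (trans P.at-end (sym Q.at-start))
  glued-q (suc j) | yes L₁+sj≤L₁ = contradiction L₁+sj≤L₁ (<⇒≱ (m<m+n L₁ (s≤s z≤n)))

  glued-0 : glued 0 ≡ Q.at (suc l₂)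
  glued-0 = trans (glued-p z≤n) (trans P.at-start (sym Q.at-end))

  data Placement : ℕ → ℕ → Set where
    on-p   : ∀ {i j} → j ≤ L₁ → Placement i j
    on-q   : ∀ i′ j′ → Placement (L₁ + i′) (L₁ + j′)
    wraps  : ∀ j′ → Placement 0 (L₁ + j′)
    across : ∀ {i} j′ → 0 < i → i < L₁ → 0 < j′ → Placement i (L₁ + j′)

  placement : ∀ {i j} → i < j → Placement i j
  placement {i} {j} i<j with j ≤? L₁
  ... | yes j≤L₁ = on-p j≤L₁
  ... | no j≰L₁ with m≤n⇒∃[o]m+o≡n (≰⇒> j≰L₁)
  ...   | j′ , refl with L₁ ≤? i
  ...     | yes L₁≤i with m≤n⇒∃[o]m+o≡n L₁≤i
  ...       | i′ , refl = subst (Placement (L₁ + i′)) (+-suc L₁ j′) (on-q i′ (suc j′))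
  placement {zero} _ | no _ | j′ , refl | no _ = subst (Placement 0) (+-suc L₁ j′) (wraps (suc j′))
  placement {suc i} _ | no _ | j′ , refl | no i≱L₁ =
    subst (Placement (suc i)) (+-suc L₁ j′) (across (suc j′) (s≤s z≤n) (≰⇒> i≱L₁) (s≤s z≤n))

  in-q : ∀ {j′} → L₁ + j′ < m → j′ < suc l₂
  in-q {j′} = +-cancelˡ-< L₁ j′ (suc l₂)

  m∸1 : m ∸ 1 ≡ L₁ + l₂
  m∸1 = cong (_∸ 1) (+-suc L₁ l₂)

  glued-distinct : ∀ {i j} → i < j → j < m → glued i ≢ glued j
  glued-distinct i<j j<m with placement i<j
  ... | on-p j≤L₁ = subst₂ _≢_ (sym (glued-p (≤-trans (<⇒≤ i<j) j≤L₁))) (sym (glued-p j≤L₁))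
                             (P′.distinct _ _ i<j j≤L₁)
  ... | on-q i′ j′ = subst₂ _≢_ (sym (glued-q i′)) (sym (glued-q j′))
                              (Q′.distinct i′ j′ (+-cancelˡ-< L₁ i′ j′ i<j) (<⇒≤ (in-q j<m)))
  ... | wraps j′ = subst₂ _≢_ (sym glued-0) (sym (glued-q j′))
                            (≢-sym (Q′.distinct j′ (suc l₂) (in-q j<m) ≤-refl))
  ... | across j′ 0<i i<L₁ 0<j′ = subst₂ _≢_ (sym (glued-p (<⇒≤ i<L₁))) (sym (glued-q j′))
      λ eq → disjoint (P.interior _ 0<i i<L₁) (subst U₂ (sym eq) (Q.interior j′ 0<j′ (in-q j<m)))

  glued-chordless : ∀ {i j} → suc i < j → j < m → ¬ (i ≡ 0 × j ≡ m ∸ 1) → ¬ glued i ~ glued j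
  glued-chordless {i} si<j j<m not-wrap with placement (<-trans (n<1+n i) si<j)
  ... | on-p j≤L₁ = subst₂ (λ x y → ¬ x ~ y) (sym (glued-p (≤-trans (<⇒≤ (<-trans (n<1+n i) si<j)) j≤L₁)))
                           (sym (glued-p j≤L₁)) (P′.chordless _ _ si<j j≤L₁)
  ... | on-q i′ j′ = subst₂ (λ x y → ¬ x ~ y) (sym (glued-q i′)) (sym (glued-q j′))
      (Q′.chordless i′ j′ (+-cancelˡ-< L₁ (suc i′) j′ (subst (_< L₁ + j′) (sym (+-suc L₁ i′)) si<j))
                    (<⇒≤ (in-q j<m)))
  ... | wraps j′ = subst₂ (λ x y → ¬ x ~ y) (sym glued-0) (sym (glued-q j′))
      λ e → Q′.chordless j′ (suc l₂) (s≤s j′<l₂) ≤-refl (~-sym e)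
    where
    j′<l₂ : j′ < l₂
    j′<l₂ = ≤∧≢⇒< (≤-pred (in-q j<m)) λ j′≡l₂ → not-wrap (refl , trans (cong (L₁ +_) j′≡l₂) (sym m∸1))
  ... | across j′ 0<i i<L₁ 0<j′ = subst₂ (λ x y → ¬ x ~ y) (sym (glued-p (<⇒≤ i<L₁))) (sym (glued-q j′))
      (apart (P.interior _ 0<i i<L₁) (Q.interior j′ 0<j′ (in-q j<m)))

  glued-edge : ∀ k → suc k < m → glued k ~ glued (suc k)
  glued-edge k sk<m with L₁ ≤? k
  ... | no k≱L₁ = subst₂ _~_ (sym (glued-p (<⇒≤ (≰⇒> k≱L₁)))) (sym (glued-p (≰⇒> k≱L₁))) (P.edge k (≰⇒> k≱L₁))
  ... | yes L₁≤k with m≤n⇒∃[o]m+o≡n L₁≤k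
  ...   | k′ , refl = subst₂ _~_ (sym (glued-q k′)) (trans (sym (glued-q (suc k′))) (cong glued (+-suc L₁ k′)))
                             (Q.edge k′ (<⇒≤ (in-q (subst (_< m) (sym (+-suc L₁ k′)) sk<m))))

  glued-wrap : glued (m ∸ 1) ~ glued 0
  glued-wrap = subst₂ _~_ (trans (sym (glued-q l₂)) (cong glued (sym m∸1))) (sym glued-0) (Q.edge l₂ ≤-refl)

  cycle : Fin m → Fin n
  cycle k = glued (toℕ k)

  cycle-isCycle : IsCycle G m cycle
  cycle-isCycle = injective , consecutive
    where
    injective : ∀ {i j} → cycle i ≡ cycle j → i ≡ j
    injective {i} {j} eq with <-cmp (toℕ i) (toℕ j)
    ... | tri< i<j _ _ = contradiction eq (glued-distinct i<j (toℕ<n j))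
    ... | tri≈ _ i≡j _ = toℕ-injective i≡j
    ... | tri> _ _ j<i = contradiction (sym eq) (glued-distinct j<i (toℕ<n i))

    consecutive : ∀ i j → CycNext G m i j → cycle i ~ cycle j
    consecutive i j (inj₁ j≡1+i) =
      subst (λ k → cycle i ~ glued k) (sym j≡1+i) (glued-edge (toℕ i) (subst (_< m) j≡1+i (toℕ<n j)))
    consecutive i j (inj₂ (i≡m∸1 , j≡0)) = subst₂ (λ x y → glued x ~ glued y) (sym i≡m∸1) (sym j≡0) glued-wrap

  cycle-chordless : ¬ HasChord G m cycle
  cycle-chordless (i , j , i≢j , ¬i→j , ¬j→i , chord) with <-cmp (toℕ i) (toℕ j)
  ... | tri< i<j _ _ = glued-chordless (≤∧≢⇒< i<j (¬i→j ∘ inj₁ ∘ sym)) (toℕ<n j) (¬j→i ∘ inj₂ ∘ swap) chord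
  ... | tri≈ _ i≡j _ = i≢j (toℕ-injective i≡j)
  ... | tri> _ _ j<i = glued-chordless (≤∧≢⇒< j<i (¬j→i ∘ inj₁ ∘ sym)) (toℕ<n i) (¬i→j ∘ inj₂ ∘ swap) (~-sym chord)

module _ {n : ℕ} {G : Graph n} where
  open Walks G
  open Routes G

  route-length-≥2 : ∀ {U a b L} → a ≢ b → ¬ a ~ b → Route U a b L → 2 ≤ L
  route-length-≥2 {L = zero} a≢b _ p = contradiction (trans (sym at-start) at-end) a≢b
    where open Route p
  route-length-≥2 {L = suc zero} _ a≁b p = contradiction (subst₂ _~_ at-start at-end (edge 0 ≤-refl)) a≁b
    where open Route p
  route-length-≥2 {L = suc (suc _)} _ _ _ = s≤s (s≤s z≤n)

  separated-routes-absurd : Chordal G → ∀ {U₁ U₂ a a′ L₁ L₂} → a ≢ a′ → ¬ a ~ a′ →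
    (∀ {x} → U₁ x → ¬ U₂ x) → (∀ {x y} → U₁ x → U₂ y → ¬ x ~ y) →
    Route U₁ a a′ L₁ → Route U₂ a′ a L₂ → ⊥
  separated-routes-absurd chordal a≢a′ a≁a′ disjoint apart p q
    with induced-route p | induced-route q
  ... | L₁ , p′ , p-induced | L₂ , q′ , q-induced
    with route-length-≥2 a≢a′ a≁a′ p′ | route-length-≥2 (≢-sym a≢a′) (a≁a′ ∘ ~-sym) q′
  ... | 2≤L₁ | s≤s 1≤l₂ = cycle-chordless (chordal m cycle (+-mono-≤ 2≤L₁ (s≤s 1≤l₂)) cycle-isCycle)
    where open Gluing disjoint apart p′ p-induced q′ q-induced

module Layers {n : ℕ} (G : Graph n) (connected : Connected G) (chordal : Chordal G) (z : Fin n) where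
  open Walks G
  open Routes G
  open Distance G connected

  level : Fin n → ℕ
  level x = dist x z

  level-~ : ∀ {x y} → x ~ y → level x ≤ suc (level y)
  level-~ = dist-~-≤ z

  level-drop : ∀ {i x b} → suc i ≤ level x → x ~ b → level b < suc i → level b ≡ i
  level-drop i<lx x~b lb≤i = ≤-antisym (≤-pred lb≤i) (≤-pred (≤-trans i<lx (level-~ x~b)))

  descent : ∀ {j} y → level y ≤ j → WalkIn (λ x → level x ≤ j) y z
  descent {j} y ly≤j = go (level y) refl ly≤j
    where
    go : ∀ k {y} → level y ≡ k → k ≤ j → WalkIn (λ x → level x ≤ j) y z
    go zero ly≡0 _ with dist≡0⇒≡ ly≡0
    ... | refl = stay (subst (_≤ j) (sym ly≡0) z≤n)
    go (suc k) ly≡sk sk≤j with dist-next ly≡sk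
    ... | y′ , y~y′ , ly′≡k = move (subst (_≤ j) (sym ly≡sk) sk≤j) y~y′ (go k ly′≡k (≤-trans (n≤1+n k) sk≤j))

  -- Otherwise a ~ x ⋯ x′ ~ a′ above the layer of a and a′ ⋯ z ⋯ a below it, along geodesics
  -- to z, bound a chordless cycle.
  lower-neighbours-meet : ∀ {i x x′ a a′} → WalkIn (λ y → i ≤ level y) x x′ →
    x ~ a → x′ ~ a′ → level a < i → level a′ < i → a ≡ a′ ⊎ a ~ a′
  lower-neighbours-meet {zero} _ _ _ () _
  lower-neighbours-meet {suc zero} _ _ _ la<1 la′<1 =
    inj₁ (trans (dist≡0⇒≡ (n<1⇒n≡0 la<1)) (sym (dist≡0⇒≡ (n<1⇒n≡0 la′<1))))
  lower-neighbours-meet {suc (suc j)} {a = a} {a′} above x~a x′~a′ la<i la′<i with a ≟ᶠ a′ | a ~? a′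
  ... | yes a≡a′ | _ = inj₁ a≡a′
  ... | no _ | yes a~a′ = inj₂ a~a′
  ... | no a≢a′ | no a≁a′ with dist-next (level-drop (walkIn-start above) x~a la<i)
                              | dist-next (level-drop (walkIn-end above) x′~a′ la′<i)
  ...   | h , a~h , lh≡j | g , a′~g , lg≡j =
    ⊥-elim (separated-routes-absurd chordal a≢a′ a≁a′ disjoint apart
              (proj₂ (bracket (~-sym x~a) above x′~a′))
              (proj₂ (bracket a′~g (descent g (≤-reflexive lg≡j) ++ⁱ reverseⁱ (descent h (≤-reflexive lh≡j)))
                              (~-sym a~h))))
    where
    disjoint : ∀ {x} → suc (suc j) ≤ level x → ¬ level x ≤ j
    disjoint i≤lx = <⇒≱ (≤-trans (n≤1+n (suc j)) i≤lx)

    apart : ∀ {x y} → suc (suc j) ≤ level x → level y ≤ j → ¬ x ~ y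
    apart i≤lx ly≤j x~y = <⇒≱ i≤lx (≤-trans (level-~ x~y) (s≤s ly≤j))

  reach-layer : ∀ {T} k {y} → 1 ≤ T → level y ≡ k → T ≤ k →
    ∃ λ g → ∃ λ g′ → WalkIn (λ x → T ≤ level x) y g × g ~ g′ × level g′ < T × dist y g′ + T ≤ suc k
  reach-layer zero 1≤T _ T≤0 = contradiction (≤-trans 1≤T T≤0) λ ()
  reach-layer {T} (suc k) {y} 1≤T ly≡sk T≤sk with dist-next ly≡sk
  ... | y′ , y~y′ , ly′≡k with T ≤? k
  ...   | no T≰k = y , y′ , stay (subst (T ≤_) (sym ly≡sk) T≤sk) , y~y′ ,
                   subst (_< T) (sym ly′≡k) (≰⇒> T≰k) , +-mono-≤ (dist-~ y~y′) T≤sk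
  ...   | yes T≤k with reach-layer k 1≤T ly′≡k T≤k
  ...     | g , g′ , up , g~g′ , g′-below , close =
            g , g′ , move (subst (T ≤_) (sym ly≡sk) T≤sk) y~y′ up , g~g′ , g′-below ,
            ≤-trans (+-monoˡ-≤ T (dist-~-≤ g′ y~y′)) (s≤s close)

  module _ {v w} (v~w : v ~ w) (w-below : level w < level v) where

    -- Follow the walk from q while it stays at or above the level of v: the first vertex below it,
    -- or else the vertex below it on a geodesic from y to z, is w or adjacent to w.
    escape : ∀ {q y m} → WalkIn (λ x → level v ≤ level x) v q → Walk G q y m →
             dist w y ≤ m ⊎ dist w y + level v ≤ 2 + level y
    escape {y = y} above here with reach-layer (level y) (≤-trans (s≤s z≤n) w-below) refl (walkIn-end above)
    ... | g , g′ , up , g~g′ , g′-below , close = inj₂ (begin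
      dist w y + level v          ≤⟨ +-monoˡ-≤ (level v) (dist-≡⊎~ y w-meets-g′) ⟩
      suc (dist g′ y) + level v   ≡⟨ cong (λ d → suc d + level v) (dist-sym g′ y) ⟩
      suc (dist y g′ + level v)   ≤⟨ s≤s close ⟩
      2 + level y                 ∎)
      where
      open ≤-Reasoning
      w-meets-g′ = lower-neighbours-meet (above ++ⁱ up) v~w g~g′ w-below g′-below
    escape {y = y} above (step {w = q′} q~q′ rest) with level v ≤? level q′
    ... | yes q′-above = map₁ m≤n⇒m≤1+n (escape (snocⁱ above q~q′ q′-above) rest)
    ... | no q′-below = inj₁ (≤-trans (dist-≡⊎~ y (lower-neighbours-meet above v~w q~q′ w-below (≰⇒> q′-below)))
                                   (s≤s (dist-minimal rest)))

sum-bounds⇒< : ∀ {a t b d} → a + t ≤ 2 + b → b + 3 ≤ t + d → a < d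
sum-bounds⇒< {a} {t} {b} {d} h₁ h₂ = +-cancelʳ-≤ (t + 2) (suc a) d (begin
  suc a + (t + 2) ≡⟨ e₁ a t ⟩
  a + t + 3       ≤⟨ +-monoˡ-≤ 3 h₁ ⟩
  2 + b + 3       ≡⟨ e₂ b ⟩
  b + 3 + 2       ≤⟨ +-monoˡ-≤ 2 h₂ ⟩
  t + d + 2       ≡⟨ e₃ t d ⟩
  d + (t + 2)     ∎)
  where
  open ≤-Reasoning
  e₁ : ∀ a t → suc a + (t + 2) ≡ a + t + 3
  e₁ = solve-∀
  e₂ : ∀ b → 2 + b + 3 ≡ b + 3 + 2
  e₂ = solve-∀
  e₃ : ∀ t d → t + d + 2 ≡ d + (t + 2)
  e₃ = solve-∀

module Projections {n : ℕ} (G : Graph n) (connected : Connected G) (chordal : Chordal G) (v : Fin n) where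
  open Walks G
  open Distance G connected

  Toward : Fin n → Pred (Fin n) 0ℓ
  Toward z p = v ~ p × dist p z < dist v z

  toward? : ∀ z → Decidable (Toward z)
  toward? z p = (v ~? p) ×-dec (suc (dist p z) ≤? dist v z)

  toward-comparable : ∀ {z y} → dist z y + 3 ≤ dist v z + dist v y →
                      Toward z ⊆ Toward y ⊎ Toward y ⊆ Toward z
  toward-comparable {z} {y} far with any? (λ p → toward? y p ×-dec ¬? (toward? z p))
  ... | no none = inj₂ λ {p} p∈y → decidable-stable (toward? z p) λ p∉z → none (p , p∈y , p∉z)
  ... | yes (p , (v~p , p-closer) , p∉z) = inj₁ λ {w} (v~w , w-below) → v~w , closer v~w w-below
    where
    open Layers G connected chordal z

    closer : ∀ {w} → v ~ w → level w < level v → dist w y < dist v y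
    closer v~w w-below with escape v~w w-below (move ≤-refl v~p (stay (≮⇒≥ λ lp<lv → p∉z (v~p , lp<lv))))
                                   (dist-walk p y)
    ... | inj₁ w≤p = <-≤-trans (s≤s w≤p) p-closer
    ... | inj₂ bound = sum-bounds⇒< (subst (λ d → dist _ y + level v ≤ 2 + d) (dist-sym y z) bound) far

  module _ {k} (ecc-v : Ecc v k) {c r} (ecc-c : ∀ y → dist c y ≤ r) (gap : 2 + r ≤ k) where

    Farthest : Pred (Fin n) 0ℓ
    Farthest y = dist v y ≡ k

    Pivot : Pred (Fin n) 0ℓ
    Pivot z = 0 < dist v z × (∀ {y} → Farthest y → dist z y + 3 ≤ dist v z + dist v y) × Toward z ⊆ Toward c

    2≤dist-v-c : 2 ≤ dist v c
    2≤dist-v-c = +-cancelʳ-≤ r 2 (dist v c) (begin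
      2 + r                  ≤⟨ gap ⟩
      k                      ≡⟨ sym attained ⟩
      dist v ys              ≤⟨ dist-triangle v c ys ⟩
      dist v c + dist c ys   ≤⟨ +-monoʳ-≤ (dist v c) (ecc-c ys) ⟩
      dist v c + r           ∎)
      where
      open ≤-Reasoning
      ys = proj₁ (proj₂ ecc-v)
      attained = proj₂ (proj₂ ecc-v)

    pivot-c : Pivot c
    pivot-c = ≤-trans (s≤s z≤n) 2≤dist-v-c , far , id
      where
      far : ∀ {y} → Farthest y → dist c y + 3 ≤ dist v c + dist v y
      far {y} refl = begin
        dist c y + 3      ≤⟨ +-monoˡ-≤ 3 (ecc-c y) ⟩
        r + 3             ≡⟨ +-comm r 3 ⟩
        1 + (2 + r)       ≤⟨ +-mono-≤ (≤-trans (s≤s z≤n) 2≤dist-v-c) gap ⟩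
        dist v c + k      ∎
        where open ≤-Reasoning

    pivot-farthest : ∀ {x} → Farthest x → ∀ {z} → Toward x ⊆ Toward z → Pivot z → Pivot x
    pivot-farthest {x} fx x⊆z (_ , _ , z⊆c) = subst (0 <_) (sym fx) (≤-trans (s≤s z≤n) gap) , far , z⊆c ∘ x⊆z
      where
      far : ∀ {y} → Farthest y → dist x y + 3 ≤ dist v x + dist v y
      far {y} fy = begin
        dist x y + 3             ≤⟨ +-monoˡ-≤ 3 (dist-triangle x c y) ⟩
        dist x c + dist c y + 3  ≤⟨ +-monoˡ-≤ 3 (+-mono-≤ (subst (_≤ r) (dist-sym c x) (ecc-c x)) (ecc-c y)) ⟩
        r + r + 3                ≡⟨ regroup r ⟩
        (2 + r) + (1 + r)        ≤⟨ +-mono-≤ gap (≤-trans (n≤1+n (1 + r)) gap) ⟩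
        k + k                    ≡⟨ cong₂ _+_ (sym fx) (sym fy) ⟩
        dist v x + dist v y      ∎
        where
        open ≤-Reasoning
        regroup : ∀ r → r + r + 3 ≡ (2 + r) + (1 + r)
        regroup = solve-∀

    pivots-comparable : ∀ {z x} → Pivot z → Farthest x → Toward z ⊆ Toward x ⊎ Toward x ⊆ Toward z × Pivot x
    pivots-comparable pivot@(_ , far , _) fx with toward-comparable (far fx)
    ... | inj₁ z⊆x = inj₁ z⊆x
    ... | inj₂ x⊆z = inj₂ (x⊆z , pivot-farthest fx x⊆z pivot)

    neighbour-closer-to-all : ∃ λ w → v ~ w × ∀ y → dist w y < k
    neighbour-closer-to-all
      with least-image Toward (λ x → dist v x ≟ k) pivots-comparable (allFin n) pivot-c
    ... | z , (0<dvz , _ , z⊆c) , _ , below with dist-toward 0<dvz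
    ...   | w , v~w , w-closer = w , v~w , bound
      where
      bound : ∀ y → dist w y < k
      bound y with dist v y ≟ k
      ... | yes fy = subst (dist w y <_) fy (proj₂ (below (∈-allFin y) fy (v~w , w-closer)))
      ... | no ¬fy with escape v~w (proj₂ (z⊆c (v~w , w-closer))) (stay ≤-refl) (dist-walk v y)
        where open Layers G connected chordal c
      ...   | inj₁ w≤v = ≤-<-trans w≤v (≤∧≢⇒< (proj₁ ecc-v y) ¬fy)
      ...   | inj₂ detour = <-≤-trans (s≤s (+-cancelʳ-≤ 2 (dist w y) r (begin
        dist w y + 2           ≤⟨ +-monoʳ-≤ (dist w y) 2≤dist-v-c ⟩
        dist w y + dist v c    ≤⟨ detour ⟩
        2 + dist y c           ≤⟨ +-monoʳ-≤ 2 (subst (_≤ r) (dist-sym c y) (ecc-c y)) ⟩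
        2 + r                  ≡⟨ +-comm 2 r ⟩
        r + 2                  ∎))) (≤-trans (n≤1+n (suc r)) gap)
        where open ≤-Reasoning

module Certificate {n : ℕ} (G : Graph n) (connected : Connected G) (chordal : Chordal G)
                   {c r} (ecc-c : Distance.Ecc G connected c r) where
  open Distance G connected
  open Projections G connected chordal using (neighbour-closer-to-all)

  descend-to-C¹ : ∀ k u → Ecc u k → ∃ λ x → ∃ λ ex → Ecc x ex × ex ≤ r + 1 × k ≡ dist u x + ex
  descend-to-C¹ k u ecc-u with k ≤? r + 1
  ... | yes k≤r+1 = u , k , ecc-u , k≤r+1 , cong (_+ k) (sym (dist-self u))
  descend-to-C¹ zero u ecc-u | no k≰r+1 = contradiction z≤n k≰r+1
  descend-to-C¹ (suc k) u ecc-u@(_ , ys , attained) | no k≰r+1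
    with neighbour-closer-to-all u ecc-u (proj₁ ecc-c) (subst (_≤ suc k) (cong suc (+-comm r 1)) (≰⇒> k≰r+1))
  ... | w , u~w , w-closer with descend-to-C¹ k w ecc-w
    where
    ecc-w : Ecc w k
    ecc-w = (λ y → ≤-pred (w-closer y)) , ys ,
            ≤-antisym (≤-pred (w-closer ys)) (≤-pred (subst (_≤ suc (dist w ys)) attained (dist-~-≤ ys u~w)))
  ...   | x , ex , ecc-x , ex≤r+1 , k≡ =
    x , ex , ecc-x , ex≤r+1 , ≤-antisym (ecc-triangle ecc-u ecc-x)
      (≤-trans (+-monoˡ-≤ ex (dist-~-≤ x u~w)) (s≤s (≤-reflexive (sym k≡))))

  C¹-attains : ∀ {u eu} → IsEcc G u eu →
    ∃[ x ] ∃[ dx ] ∃[ ex ] (IsDist G u x dx × IsEcc G x ex × ex ≤ r + 1 × eu ≡ dx + ex)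
  C¹-attains {u} {eu} ecc-u with descend-to-C¹ eu u (IsEcc⇒Ecc ecc-u)
  ... | x , ex , ecc-x , ex≤r+1 , eu≡ = x , dist u x , ex , isDist-dist u x , Ecc⇒IsEcc ecc-x , ex≤r+1 , eu≡

proposition9 : ∀ {n} (G : Graph n) → Connected G → Chordal G →
    ∀ r → IsRad G r →
    ∀ u eu → IsEcc G u eu →
      (∀ x dx ex → IsDist G u x dx → IsEcc G x ex → ex ≤ r + 1 → eu ≤ dx + ex)
      × (∃[ x ] ∃[ dx ] ∃[ ex ] (IsDist G u x dx × IsEcc G x ex × ex ≤ r + 1 × eu ≡ dx + ex))
proposition9 G connected chordal r ((c , ecc-c) , _) u eu ecc-u =
  (λ x dx ex dist-x ecc-x _ → isEcc-triangle ecc-u dist-x ecc-x) , C¹-attains ecc-u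
  where
  open Distance G connected
  open Certificate G connected chordal (IsEcc⇒Ecc ecc-c)
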